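{- Let $(G,L)$ be a feasible Leaf-to-Leaf+ CacAP instance with root $r$ and leaf set $T$, let $M\subseteq L$ be a matching on the leaves of $G$ containing no bad link, and let $\mathcal L\subseteq\mathcal C^M$ be a laminar family. Then the optimum value of $$\min\Big\{x(\vec L): x\in\mathbb R^{\vec L}_{\ge0},\ x(\delta^-_{\vec L}(C))\ge1\ \text{ for all } C\in\mathcal L\Big\}$$ is at most $\tfrac12|M_{\mathrm{in}}|+(|T|-2|M|)$.
   Context: A cactus is a connected multigraph $G=(V,E)$ in which every edge lies in exactly one cycle (pairs of parallel edges count as cycles). CacAP instance $(G,L)$: cactus $G$, links $L\subseteq\binom V2$; a solution is $F\subseteq L$ with $(V,E\cup F)$ $3$-edge-connected; feasible if $L$ is a solution. Leaves: degree-$2$ vertices. Leaf-to-Leaf+ with root $r$: every link endpoint is $r$ or a leaf. A link is an in-link if both endpoints lie in the same connected component of $G-r$; $M_{\mathrm{in}}$ is the set of in-links of $M$. A matching on the leaves is a set of pairwise disjoint links whose endpoints are leaves. $\mathcal C=\{C\subseteq V\setminus\{r\}:|\delta_E(C)|=2\}$; a link covers $C$ if exactly one endpoint is in $C$. For $C\in\mathcal C$, $T_C$ = leaves in $C$ that are endpoints of links of $L$ covering $C$; a link $\{u,v\}$ is bad if $T_C\subseteq\{u,v\}\subseteq C$ for some $C\in\mathcal C$. $\mathcal C^M=\{C\in\mathcal C:\text{no link of }M\text{ covers }C\}$. $\vec L=\bigcup_{\{u,v\}\in L}\{(u,v),(v,u)\}$; $\delta^-_{\vec L}(C)$ is the set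 of $(u,v)\in\vec L$ with $u\notin C$, $v\in C$. A family of sets is laminar if any two members are disjoint or nested. -}

module Defs where

open import Data.Nat using (ℕ; zero; suc; _+_; _*_; _≤_)
open import Data.Bool using (Bool; true; false; _xor_; _∧_; not; if_then_else_)
open import Data.Fin using (Fin; zero; suc; inject₁; fromℕ; _≟_)
open import Data.Fin.Subset using (Subset; _∈_; _∉_; _⊆_; _∩_; Empty; ∣_∣)
open import Data.Vec using (lookup)
open import Data.Product using (_×_; _,_; proj₁; proj₂; Σ; ∃; ∃-syntax)
open import Data.Sum using (_⊎_)
open import Data.List using (List)
open import Data.List.Membership.Propositional using () renaming (_∈_ to _∈ˡ_)
open import Relation.Binary.PropositionalEquality using (_≡_; _≢_)
open import Relation.Nullary using (¬_; does)
open import Function.Definitions using (Injective)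
open import Data.Rational as ℚ using (ℚ; 0ℚ)

count : ∀ {k} → (Fin k → Bool) → ℕ
count {zero}  p = 0
count {suc k} p = (if p zero then 1 else 0) + count (λ i → p (suc i))

sumℚ : ∀ {k} → (Fin k → ℚ) → ℚ
sumℚ {zero}  f = 0ℚ
sumℚ {suc k} f = f zero ℚ.+ sumℚ (λ i → f (suc i))

-- Multigraphs on vertex set Fin n with edges indexed by Fin m
-- (an edge is an (unordered) pair of endpoints, parallel edges allowed).

Edges : ℕ → ℕ → Set
Edges n m = Fin m → Fin n × Fin n

Joins : ∀ {n m} → Edges n m → Fin m → Fin n → Fin n → Set
Joins E e a b = (E e ≡ (a , b)) ⊎ (E e ≡ (b , a))

data Walk {n} (adj : Fin n → Fin n → Set) : Fin n → Fin n → Set where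
  here : ∀ {u} → Walk adj u u
  step : ∀ {u w v} → adj u w → Walk adj w v → Walk adj u v

AdjG : ∀ {n m} → Edges n m → Fin n → Fin n → Set
AdjG E u w = ∃[ e ] Joins E e u w

AdjG-r : ∀ {n m} → Edges n m → Fin n → Fin n → Fin n → Set
AdjG-r E r u w = (∃[ e ] Joins E e u w) × u ≢ r × w ≢ r

Connected : ∀ {n m} → Edges n m → Set
Connected E = ∀ u v → Walk (AdjG E) u v

-- A cycle of length j+2: distinct vertices vs 0..j+1 and distinct edges
-- es 0..j+1, edge es i joining vs i and vs (i+1 mod (j+2)).
record Cycle {n m} (E : Edges n m) : Set where
  field
    j      : ℕ
    vs     : Fin (suc (suc j)) → Fin n
    es     : Fin (suc (suc j)) → Fin m
    vs-inj : Injective _≡_ _≡_ vs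
    es-inj : Injective _≡_ _≡_ es
    links  : ∀ (i : Fin (suc j)) → Joins E (es (inject₁ i)) (vs (inject₁ i)) (vs (suc i))
    close  : Joins E (es (fromℕ (suc j))) (vs (fromℕ (suc j))) (vs zero)

InCycle : ∀ {n m} {E : Edges n m} → Fin m → Cycle E → Set
InCycle e c = ∃[ i ] Cycle.es c i ≡ e

SameEdgeSet : ∀ {n m} {E : Edges n m} → Cycle E → Cycle E → Set
SameEdgeSet c d = ∀ e → (InCycle e c → InCycle e d) × (InCycle e d → InCycle e c)

-- every edge lies in exactly one cycle (cycles identified by edge sets)
IsCactus : ∀ {n m} → Edges n m → Set
IsCactus E = Connected E ×
  (∀ e → Σ (Cycle E) (λ c → InCycle e c) ×
         (∀ (c d : Cycle E) → InCycle e c → InCycle e d → SameEdgeSet c d))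

deg : ∀ {n m} → Edges n m → Fin n → ℕ
deg E v = count (λ e → does (proj₁ (E e) ≟ v)) + count (λ e → does (proj₂ (E e) ≟ v))

IsLeaf : ∀ {n m} → Edges n m → Fin n → Set
IsLeaf E v = deg E v ≡ 2

isLeafᵇ : ∀ {n m} → Edges n m → Fin n → Bool
isLeafᵇ E v = does (Data.Nat._≟_ (deg E v) 2)

numLeaves : ∀ {n m} → Edges n m → ℕ
numLeaves {n} E = count (isLeafᵇ E)

inᵇ : ∀ {n} → Subset n → Fin n → Bool
inᵇ C x = lookup C x

crossesᵇ : ∀ {n} → Subset n → Fin n × Fin n → Bool
crossesᵇ C (a , b) = inᵇ C a xor inᵇ C b

cutE : ∀ {n m} → Edges n m → Subset n → ℕ
cutE E C = count (λ e → crossesᵇ C (E e))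

-- Links: a set L ⊆ binom(V,2) indexed by Fin k (distinct endpoints,
-- no two indices giving the same unordered pair).

Links : ℕ → ℕ → Set
Links n k = Fin k → Fin n × Fin n

IsLinkSet : ∀ {n k} → Links n k → Set
IsLinkSet L = (∀ i → proj₁ (L i) ≢ proj₂ (L i)) ×
              (∀ i i' → (L i ≡ L i' ⊎ L i ≡ (proj₂ (L i') , proj₁ (L i'))) → i ≡ i')

cutL : ∀ {n k} → Links n k → Subset n → ℕ
cutL L C = count (λ i → crossesᵇ C (L i))

-- (V, E ∪ L) is 3-edge-connected, i.e. L is a solution: the instance is feasible
Feasible : ∀ {n m k} → Edges n m → Links n k → Set
Feasible E L = ∀ (S : Subset _) → (∃[ x ] x ∈ S) → (∃[ y ] y ∉ S) → 3 ≤ cutE E S + cutL L S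

LeafToLeafPlus : ∀ {n m k} → Edges n m → Links n k → Fin n → Set
LeafToLeafPlus E L r = ∀ i → (proj₁ (L i) ≡ r ⊎ IsLeaf E (proj₁ (L i)))
                            × (proj₂ (L i) ≡ r ⊎ IsLeaf E (proj₂ (L i)))

InLink : ∀ {n m} → Edges n m → Fin n → Fin n × Fin n → Set
InLink E r (u , v) = u ≢ r × v ≢ r × Walk (AdjG-r E r) u v

Covers : ∀ {n} → Fin n × Fin n → Subset n → Set
Covers ℓ C = crossesᵇ C ℓ ≡ true

InFamC : ∀ {n m} → Edges n m → Fin n → Subset n → Set
InFamC E r C = r ∉ C × cutE E C ≡ 2

InTC : ∀ {n m k} → Edges n m → Links n k → Subset n → Fin n → Set
InTC E L C t = t ∈ C × IsLeaf E t ×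
  (∃[ i ] Covers (L i) C × (proj₁ (L i) ≡ t ⊎ proj₂ (L i) ≡ t))

Bad : ∀ {n m k} → Edges n m → Links n k → Fin n → Fin n × Fin n → Set
Bad E L r (u , v) = ∃[ C ] InFamC E r C ×
  (∀ t → InTC E L C t → t ≡ u ⊎ t ≡ v) × u ∈ C × v ∈ C

IsLeafMatching : ∀ {n m k} → Edges n m → Links n k → Subset k → Set
IsLeafMatching E L M =
  (∀ i → i ∈ M → IsLeaf E (proj₁ (L i)) × IsLeaf E (proj₂ (L i))) ×
  (∀ i i' → i ∈ M → i' ∈ M → i ≢ i' →
     ∀ x → (proj₁ (L i) ≡ x ⊎ proj₂ (L i) ≡ x) → ¬ (proj₁ (L i') ≡ x ⊎ proj₂ (L i') ≡ x))

InFamCM : ∀ {n m k} → Edges n m → Links n k → Fin n → Subset k → Subset n → Set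
InFamCM E L r M C = InFamC E r C × (∀ i → i ∈ M → ¬ Covers (L i) C)

Laminar : ∀ {n} → List (Subset n) → Set
Laminar 𝓛 = ∀ A B → A ∈ˡ 𝓛 → B ∈ˡ 𝓛 → Empty (A ∩ B) ⊎ A ⊆ B ⊎ B ⊆ A

-- The LP.  x ∈ ℚ^{L⃗}: for link i = {u,v} (stored as (u , v)),
-- xf i = x(u,v) and xb i = x(v,u).

inflow : ∀ {n k} → Links n k → (Fin k → ℚ) → (Fin k → ℚ) → Subset n → ℚ
inflow L xf xb C = sumℚ (λ i →
  (if not (inᵇ C (proj₁ (L i))) ∧ inᵇ C (proj₂ (L i)) then xf i else 0ℚ) ℚ.+
  (if not (inᵇ C (proj₂ (L i))) ∧ inᵇ C (proj₁ (L i)) then xb i else 0ℚ))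

total : ∀ {k} → (Fin k → ℚ) → (Fin k → ℚ) → ℚ
total xf xb = sumℚ (λ i → xf i ℚ.+ xb i)

LPFeasible : ∀ {n k} → Links n k → List (Subset n) → (Fin k → ℚ) → (Fin k → ℚ) → Set
LPFeasible L 𝓛 xf xb = (∀ i → 0ℚ ℚ.≤ xf i) × (∀ i → 0ℚ ℚ.≤ xb i) ×
  (∀ C → C ∈ˡ 𝓛 → ℚ.1ℚ ℚ.≤ inflow L xf xb C)

{-# OPTIONS --safe #-}
-- Work in half-units. Every leaf not covered by M sends weight 1, and every in-link of M
-- weight 1/2, along an arc of a link entering the leaf (resp. one end of the in-link) at the
-- largest member of 𝓛 in which that vertex is a terminal. Laminarity makes the members with
-- such a terminal a chain, so this arc enters all of them. The total weight is
-- |M_in|/2 + #unmatched leaves ≤ |M_in|/2 + (|T| - 2|M|). For C ∈ 𝓛, feasibility gives a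
-- terminal in T_C. If T_C has an unmatched leaf, its arc alone enters C with weight 1.
-- Otherwise each terminal of C lies on a link of M; such links are not split by C ∈ 𝒞^M, so
-- they are in-links (two vertices inside a 2-cut avoiding r are joined in G - r, because
-- every edge of a cactus lies on a cycle), and since no link of M is bad, T_C meets two
-- different links of M, each contributing 1/2.
module Submission where

open import Defs
open import Data.Fin using (Fin)
open import Data.Fin.Subset using (Subset; _∈_)
open import Data.List using (List)
open import Data.List.Relation.Unary.All using (All)
open import Data.Product using (_×_)
open import Relation.Nullary using (¬_)

module Counting where

  open import Data.Nat using (zero; suc; _+_; _≤_; _<_; z≤n; s≤s)
  open import Data.Nat.Properties using (<-irrefl; ≤-trans; m≤n+m; +-commutativeSemigroup)
  open import Algebra.Properties.CommutativeSemigroup +-commutativeSemigroup using (x∙yz≈y∙xz)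
  open import Data.Bool using (Bool; true; false; _∨_; if_then_else_)
  open import Data.Fin using (Fin; zero; suc; _≟_)
  open import Data.Product using (∃; _,_)
  open import Data.Sum using (_⊎_; inj₁; inj₂)
  open import Data.Empty using (⊥-elim)
  open import Relation.Nullary using (Dec; does; yes; no)
  open import Relation.Nullary.Decidable using (dec-false)
  open import Relation.Binary.PropositionalEquality

  count-mono : ∀ {k} {p q : Fin k → Bool} → (∀ i → p i ≡ true → q i ≡ true) → count p ≤ count q
  count-mono {zero} p⇒q = z≤n
  count-mono {suc k} {p} {q} p⇒q with p zero in p₀ | q zero in q₀
  ... | false | _     = ≤-trans (count-mono (λ i → p⇒q (suc i))) (m≤n+m _ _)
  ... | true  | true  = s≤s (count-mono (λ i → p⇒q (suc i)))
  ... | true  | false with () ← trans (sym (p⇒q zero p₀)) q₀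

  count-∨ : ∀ {k} {p q : Fin k → Bool} → (∀ i → p i ≡ true → q i ≡ false) →
            count (λ i → p i ∨ q i) ≡ count p + count q
  count-∨ {zero} disjoint = refl
  count-∨ {suc k} {p} {q} disjoint with p zero in p₀
  ... | true rewrite disjoint zero p₀ = cong suc (count-∨ (λ i → disjoint (suc i)))
  ... | false = trans (cong (_ +_) (count-∨ (λ i → disjoint (suc i)))) (x∙yz≈y∙xz (if q zero then 1 else 0) (count (λ i → p (suc i))) _)

  count-pos : ∀ {k} {p : Fin k → Bool} → 0 < count p → ∃ λ i → p i ≡ true
  count-pos {suc k} {p} pos with p zero in p₀
  ... | true  = zero , p₀
  ... | false with i , pᵢ ← count-pos pos = suc i , pᵢ

  does⇒ : ∀ {a} {A : Set a} (A? : Dec A) → does A? ≡ true → A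
  does⇒ (yes a) _ = a

  does-≟ : ∀ {k} {x y : Fin k} → does (x ≟ y) ≡ true → x ≡ y
  does-≟ {x = x} {y} = does⇒ (x ≟ y)

  ∨-true⇒⊎ : ∀ a {b} → a ∨ b ≡ true → a ≡ true ⊎ b ≡ true
  ∨-true⇒⊎ true  _      = inj₁ refl
  ∨-true⇒⊎ false b≡true = inj₂ b≡true

  count-false : ∀ {k} → count {k} (λ _ → false) ≡ 0
  count-false {zero}  = refl
  count-false {suc k} = count-false {k}

  count-≟ : ∀ {k} (j : Fin k) → count (λ i → does (j ≟ i)) ≡ 1
  count-≟ {suc k} zero = cong suc (count-false {k})
  count-≟ (suc j)      = count-≟ j

  ≟-disjoint : ∀ {k} {a b : Fin k} → a ≢ b → ∀ i → does (a ≟ i) ≡ true → does (b ≟ i) ≡ false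
  ≟-disjoint a≢b i ai = dec-false (_ ≟ i) (λ b≡i → a≢b (trans (does-≟ ai) (sym b≡i)))

  count-pair : ∀ {k} {a b : Fin k} → a ≢ b → count (λ i → does (a ≟ i) ∨ does (b ≟ i)) ≡ 2
  count-pair {a = a} {b} a≢b = trans (count-∨ (≟-disjoint a≢b)) (cong₂ _+_ (count-≟ a) (count-≟ b))

  count≤2⇒≡⊎≡ : ∀ {k} {p : Fin k → Bool} {a b c} → count p ≤ 2 → a ≢ b →
                  p a ≡ true → p b ≡ true → p c ≡ true → c ≡ a ⊎ c ≡ b
  count≤2⇒≡⊎≡ {k} {p} {a} {b} {c} count≤2 a≢b pa pb pc with c ≟ a | c ≟ b
  ... | yes c≡a | _       = inj₁ c≡a
  ... | no _    | yes c≡b = inj₂ c≡b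
  ... | no c≢a  | no c≢b  = ⊥-elim (<-irrefl refl (≤-trans three≤count count≤2))
    where
    at : Fin k → Fin k → Bool
    at x i = does (x ≟ i)

    c-apart : ∀ i → at c i ≡ true → at a i ∨ at b i ≡ false
    c-apart i ci rewrite ≟-disjoint (λ c≡a → c≢a c≡a) i ci = ≟-disjoint c≢b i ci

    three≤count : 3 ≤ count p
    three≤count = subst (_≤ count p) (trans (count-∨ c-apart) (cong₂ _+_ (count-≟ c) (count-pair a≢b)))
                        (count-mono cab⇒p)
      where
      cab⇒p : ∀ i → at c i ∨ (at a i ∨ at b i) ≡ true → p i ≡ true
      cab⇒p i hit with at c i in ci | at a i in ai | at b i in bi
      ... | true  | _     | _    = subst (λ x → p x ≡ true) (does-≟ ci) pc
      ... | false | true  | _    = subst (λ x → p x ≡ true) (does-≟ ai) pa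
      ... | false | false | true = subst (λ x → p x ≡ true) (does-≟ bi) pb

module NatSum where

  open import Data.Nat using (ℕ; zero; suc; _+_; _*_; _≤_; z≤n)
  open import Data.Nat.Properties using (+-*-semiring; +-mono-≤; +-monoʳ-≤; ≤-trans; m≤m+n; m≤n+m; *-zeroʳ; *-identityʳ; +-identityʳ; +-comm)
  open import Algebra.Properties.Semiring.Sum +-*-semiring public using (sum; ∑-distrib-+; ∑-comm; *-distribˡ-sum; sum-cong-≗; sum-replicate-zero)
  open import Data.Bool using (Bool; true; false; if_then_else_)
  open import Data.Fin using (Fin; zero; suc; _≟_)
  open import Data.Fin.Subset using (Subset; ∣_∣)
  open import Data.Fin.Subset.Properties using (_∈?_)
  open import Data.Vec using ([]; _∷_)
  open import Data.Empty using (⊥-elim)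
  open import Relation.Nullary using (does)
  open import Relation.Binary.PropositionalEquality

  𝟙 : Bool → ℕ
  𝟙 b = if b then 1 else 0

  count≡sum : ∀ {k} (p : Fin k → Bool) → count p ≡ sum (λ i → 𝟙 (p i))
  count≡sum {zero}  p = refl
  count≡sum {suc k} p = cong (𝟙 (p zero) +_) (count≡sum (λ i → p (suc i)))

  ∣∣≡count : ∀ {k} (S : Subset k) → ∣ S ∣ ≡ count (λ i → does (i ∈? S))
  ∣∣≡count []          = refl
  ∣∣≡count (true ∷ S)  = cong suc (∣∣≡count S)
  ∣∣≡count (false ∷ S) = ∣∣≡count S

  sum-mono-≤ : ∀ {k} {f g : Fin k → ℕ} → (∀ i → f i ≤ g i) → sum f ≤ sum g
  sum-mono-≤ {zero}  f≤g = z≤n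
  sum-mono-≤ {suc k} f≤g = +-mono-≤ (f≤g zero) (sum-mono-≤ (λ i → f≤g (suc i)))

  term≤sum : ∀ {k} (f : Fin k → ℕ) i → f i ≤ sum f
  term≤sum f zero    = m≤m+n _ _
  term≤sum f (suc i) = ≤-trans (term≤sum (λ j → f (suc j)) i) (m≤n+m _ (f zero))

  two-terms≤sum : ∀ {k} (f : Fin k → ℕ) {i j} → i ≢ j → f i + f j ≤ sum f
  two-terms≤sum f {zero}  {zero}  i≢j = ⊥-elim (i≢j refl)
  two-terms≤sum f {zero}  {suc j} _   = +-monoʳ-≤ (f zero) (term≤sum (λ x → f (suc x)) j)
  two-terms≤sum f {suc i} {zero}  _   =
    subst (_≤ sum f) (+-comm (f zero) (f (suc i))) (+-monoʳ-≤ (f zero) (term≤sum (λ x → f (suc x)) i))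
  two-terms≤sum f {suc i} {suc j} i≢j =
    ≤-trans (two-terms≤sum (λ x → f (suc x)) (λ i≡j → i≢j (cong suc i≡j))) (m≤n+m _ (f zero))

  sum-select : ∀ {k} (f : Fin k → ℕ) j → sum (λ i → f i * 𝟙 (does (i ≟ j))) ≡ f j
  sum-select {suc k} f zero = trans (cong₂ _+_ (*-identityʳ (f zero)) rest≡0) (+-identityʳ (f zero))
    where
    rest≡0 : sum (λ i → f (suc i) * 0) ≡ 0
    rest≡0 = trans (sum-cong-≗ (λ i → *-zeroʳ (f (suc i)))) (sum-replicate-zero k)
  sum-select f (suc j) = trans (cong (_+ sum (λ i → f (suc i) * 𝟙 (does (i ≟ j)))) (*-zeroʳ (f zero)))
                               (sum-select (λ i → f (suc i)) j)

module Half where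

  open import Data.Nat as ℕ using (ℕ; zero; suc; _∸_)
  import Data.Nat.Properties as ℕ
  open import Data.Bool using (true; false; if_then_else_)
  open import Data.Fin using (Fin; zero; suc)
  open import Data.Integer as ℤ using (ℤ; +_; _-_)
  import Data.Integer.Properties as ℤ
  open import Data.Integer.Tactic.RingSolver using (solve-∀)
  open import Data.Rational using (ℚ; _/_; _+_; _≤_; 0ℚ; toℚᵘ)
  open import Data.Rational.Properties using (toℚᵘ-fromℚᵘ; toℚᵘ-injective; toℚᵘ-homo-+; toℚᵘ-cancel-≤; module ≤-Reasoning)
  open import Data.Rational.Unnormalised as ℚᵘ using (mkℚᵘ; *≡*; *≤*) renaming (_≃_ to _≃ᵘ_)
  import Data.Rational.Unnormalised.Properties as ℚᵘ
  open import Relation.Binary.PropositionalEquality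
  open NatSum using (sum; 𝟙)

  half : ℕ → ℚ
  half a = + a / 2

  toℚᵘ-half : ∀ a → toℚᵘ (half a) ≃ᵘ mkℚᵘ (+ a) 1
  toℚᵘ-half a = toℚᵘ-fromℚᵘ (mkℚᵘ (+ a) 1)

  half-+ : ∀ a b → half (a ℕ.+ b) ≡ half a + half b
  half-+ a b = toℚᵘ-injective (begin
    toℚᵘ (half (a ℕ.+ b))              ≈⟨ toℚᵘ-half (a ℕ.+ b) ⟩
    mkℚᵘ (+ a ℤ.+ + b) 1               ≈⟨ *≡* (halves-add (+ a) (+ b)) ⟩
    mkℚᵘ (+ a) 1 ℚᵘ.+ mkℚᵘ (+ b) 1     ≈⟨ ℚᵘ.+-cong (toℚᵘ-half a) (toℚᵘ-half b) ⟨
    toℚᵘ (half a) ℚᵘ.+ toℚᵘ (half b)   ≈⟨ toℚᵘ-homo-+ (half a) (half b) ⟨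
    toℚᵘ (half a + half b)             ∎)
    where
    open ℚᵘ.≃-Reasoning
    halves-add : ∀ (x y : ℤ) → (x ℤ.+ y) ℤ.* + 4 ≡ (x ℤ.* + 2 ℤ.+ y ℤ.* + 2) ℤ.* + 2
    halves-add = solve-∀

  half-mono-≤ : ∀ {a b} → a ℕ.≤ b → half a ≤ half b
  half-mono-≤ {a} {b} a≤b = toℚᵘ-cancel-≤ (begin
    toℚᵘ (half a)  ≃⟨ toℚᵘ-half a ⟩
    mkℚᵘ (+ a) 1   ≤⟨ *≤* (ℤ.*-monoʳ-≤-nonNeg (+ 2) (ℤ.+≤+ a≤b)) ⟩
    mkℚᵘ (+ b) 1   ≃⟨ toℚᵘ-half b ⟨
    toℚᵘ (half b)  ∎)
    where open ℚᵘ.≤-Reasoning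

  0≤half : ∀ a → 0ℚ ≤ half a
  0≤half a = half-mono-≤ {b = a} ℕ.z≤n

  half-double : ∀ a → half (2 ℕ.* a) ≡ + a / 1
  half-double a = toℚᵘ-injective (begin
    toℚᵘ (half (2 ℕ.* a))  ≈⟨ toℚᵘ-half (2 ℕ.* a) ⟩
    mkℚᵘ (+ (2 ℕ.* a)) 1   ≈⟨ *≡* (double-halved (+ a)) ⟩
    mkℚᵘ (+ a) 0           ≈⟨ toℚᵘ-fromℚᵘ (mkℚᵘ (+ a) 0) ⟨
    toℚᵘ (+ a / 1)         ∎)
    where
    open ℚᵘ.≃-Reasoning
    double-halved : ∀ (x : ℤ) → (x ℤ.+ (x ℤ.+ + 0)) ℤ.* + 1 ≡ x ℤ.* + 2
    double-halved = solve-∀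

  sumℚ-half : ∀ {k} {f : Fin k → ℚ} {g : Fin k → ℕ} → (∀ i → f i ≡ half (g i)) → sumℚ f ≡ half (sum g)
  sumℚ-half {zero}          f≡ = refl
  sumℚ-half {suc k} {f} {g} f≡ = trans (cong₂ _+_ (f≡ zero) (sumℚ-half (λ i → f≡ (suc i))))
                                       (sym (half-+ (g zero) (sum (λ i → g (suc i)))))

  half-if : ∀ b a → (if b then half a else 0ℚ) ≡ half (𝟙 b ℕ.* a)
  half-if true  a = cong half (sym (ℕ.+-identityʳ a))
  half-if false a = refl

  -- d ≤ c makes the truncated c ∸ d agree with the integer difference (+ c) - (+ d).
  half-≤-split : ∀ {a b c d} → a ℕ.≤ b ℕ.+ 2 ℕ.* (c ∸ d) → d ℕ.≤ c →
                 half a ≤ + b / 2 + ((+ c) - (+ d)) / 1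
  half-≤-split {a} {b} {c} {d} a≤ d≤c = begin
    half a                             ≤⟨ half-mono-≤ a≤ ⟩
    half (b ℕ.+ 2 ℕ.* (c ∸ d))         ≡⟨ half-+ b (2 ℕ.* (c ∸ d)) ⟩
    half b + half (2 ℕ.* (c ∸ d))      ≡⟨ cong (λ q → half b + q) (half-double (c ∸ d)) ⟩
    half b + + (c ∸ d) / 1             ≡⟨ cong (λ z → half b + z / 1) c-d≡c∸d ⟨
    + b / 2 + ((+ c) - (+ d)) / 1      ∎
    where
    open ≤-Reasoning
    c-d≡c∸d : (+ c) - (+ d) ≡ + (c ∸ d)
    c-d≡c∸d = trans (ℤ.m-n≡m⊖n c d) (ℤ.⊖-≥ d≤c)

module Membership where

  open import Data.Bool using (true; false)
  open import Data.Fin.Subset using (Subset; _∈_; _∉_)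
  open import Data.Vec using (lookup)
  open import Data.Vec.Properties using ([]=⇒lookup; lookup⇒[]=)
  open import Data.Empty using (⊥-elim)
  open import Relation.Binary.PropositionalEquality

  ∈⇒lookup : ∀ {n} {C : Subset n} {x} → x ∈ C → lookup C x ≡ true
  ∈⇒lookup = []=⇒lookup

  lookup⇒∈ : ∀ {n} {C : Subset n} {x} → lookup C x ≡ true → x ∈ C
  lookup⇒∈ {C = C} {x} = lookup⇒[]= x C

  ∉⇒lookup : ∀ {n} {C : Subset n} {x} → x ∉ C → lookup C x ≡ false
  ∉⇒lookup {C = C} {x} x∉C with lookup C x in eq
  ... | true  = ⊥-elim (x∉C (lookup⇒∈ eq))
  ... | false = refl

module Graph where

  open import Data.Nat as ℕ using (zero; suc; _≤_; _<_; z≤n; s≤s)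
  import Data.Nat.Properties as ℕ
  open import Data.Bool using (true)
  open import Data.Fin using (Fin; zero; suc; toℕ; inject₁; fromℕ)
  import Data.Fin.Properties as Fin
  open import Data.Fin.Subset using (Subset; _∈_; _∉_)
  open import Data.Fin.Subset.Properties using (_∈?_)
  open import Data.Product using (Σ; _×_; _,_; ∃-syntax)
  open import Data.Sum using (_⊎_; inj₁; inj₂)
  open import Data.Unit using (⊤; tt)
  open import Data.Empty using (⊥-elim)
  open import Relation.Nullary using (yes; no)
  open import Relation.Binary.PropositionalEquality
  open Counting using (count≤2⇒≡⊎≡)
  open Membership

  module _ {n} {A : Fin n → Fin n → Set} where

    _++ʷ_ : ∀ {u v w} → Walk A u v → Walk A v w → Walk A u w
    here       ++ʷ q = q
    step a p   ++ʷ q = step a (p ++ʷ q)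

    reverseʷ : (∀ {u v} → A u v → A v u) → ∀ {u v} → Walk A u v → Walk A v u
    reverseʷ sym-A here       = here
    reverseʷ sym-A (step a p) = reverseʷ sym-A p ++ʷ step (sym-A a) here

  mapʷ : ∀ {n} {A B : Fin n → Fin n → Set} → (∀ {u v} → A u v → B u v) → ∀ {u v} → Walk A u v → Walk B u v
  mapʷ f here       = here
  mapʷ f (step a p) = step (f a) (mapʷ f p)

  last-or-inject₁ : ∀ {s} (i : Fin (suc s)) → i ≡ fromℕ s ⊎ ∃[ i′ ] i ≡ inject₁ i′
  last-or-inject₁ {zero}  zero    = inj₁ refl
  last-or-inject₁ {suc s} zero    = inj₂ (zero , refl)
  last-or-inject₁ {suc s} (suc i) with last-or-inject₁ i
  ... | inj₁ i≡last        = inj₁ (cong suc i≡last)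
  ... | inj₂ (i′ , i≡i′)   = inj₂ (suc i′ , cong suc i≡i′)

  module _ {n m} (E : Edges n m) where

    AdjVia : (Fin m → Set) → Fin n → Fin n → Set
    AdjVia P u v = ∃[ e ] (P e × Joins E e u v)

    AdjWithin : Subset n → Fin n → Fin n → Set
    AdjWithin C u v = AdjG E u v × u ∈ C × v ∈ C

    Bridgeless : Set
    Bridgeless = ∀ e {a b} → Joins E e a b → Walk (AdjVia (_≢ e)) a b

  module _ {n m} {E : Edges n m} where

    Joins-sym : ∀ {e a b} → Joins E e a b → Joins E e b a
    Joins-sym (inj₁ eq) = inj₂ eq
    Joins-sym (inj₂ eq) = inj₁ eq

    Joins-unique : ∀ {e a b x y} → Joins E e a b → Joins E e x y → (a ≡ x × b ≡ y) ⊎ (a ≡ y × b ≡ x)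
    Joins-unique (inj₁ refl) (inj₁ eq) with refl ← eq = inj₁ (refl , refl)
    Joins-unique (inj₁ refl) (inj₂ eq) with refl ← eq = inj₂ (refl , refl)
    Joins-unique (inj₂ refl) (inj₁ eq) with refl ← eq = inj₂ (refl , refl)
    Joins-unique (inj₂ refl) (inj₂ eq) with refl ← eq = inj₁ (refl , refl)

    AdjVia-sym : ∀ {P u v} → AdjVia E P u v → AdjVia E P v u
    AdjVia-sym (e , pe , j) = e , pe , Joins-sym j

    AdjWithin-sym : ∀ {C u v} → AdjWithin E C u v → AdjWithin E C v u
    AdjWithin-sym ((e , j) , u∈C , v∈C) = (e , Joins-sym j) , v∈C , u∈C

    crossing : ∀ {C e x y} → Joins E e x y → x ∈ C → y ∉ C → crossesᵇ C (E e) ≡ true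
    crossing {C} (inj₁ refl) x∈C y∉C rewrite ∈⇒lookup x∈C | ∉⇒lookup {C = C} y∉C = refl
    crossing {C} (inj₂ refl) x∈C y∉C rewrite ∈⇒lookup x∈C | ∉⇒lookup {C = C} y∉C = refl

    crossing-inner-unique : ∀ {C e x y x′ y′} → Joins E e x y → Joins E e x′ y′ →
                            x ∈ C → y ∉ C → x′ ∈ C → y′ ∉ C → x ≡ x′
    crossing-inner-unique j j′ x∈C y∉C x′∈C y′∉C with Joins-unique j j′
    ... | inj₁ (x≡x′ , _) = x≡x′
    ... | inj₂ (x≡y′ , _) = ⊥-elim (y′∉C (subst (_∈ _) x≡y′ x∈C))

    record Exit (C : Subset n) (P : Fin m → Set) (u : Fin n) : Set where
      field
        edge    : Fin m
        inner   : Fin n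
        outer   : Fin n
        allowed : P edge
        joins   : Joins E edge inner outer
        inner∈C : inner ∈ C
        outer∉C : outer ∉ C
        path    : Walk (AdjWithin E C) u inner

    exit : ∀ {C P u w} → Walk (AdjVia E P) u w → u ∈ C → w ∉ C → Exit C P u
    exit here u∈C u∉C = ⊥-elim (u∉C u∈C)
    exit {C} {u = u} (step {w = v} (e , pe , j) rest) u∈C w∉C with v ∈? C
    ... | no v∉C  = record { edge = e ; inner = u ; outer = v ; allowed = pe ; joins = j
                           ; inner∈C = u∈C ; outer∉C = v∉C ; path = here }
    ... | yes v∈C = record { Exit X ; path = step ((e , j) , u∈C , v∈C) (Exit.path X) }
      where X = exit rest v∈C w∉C

    module _ {s} (w : Fin (suc s) → Fin n) (f : Fin s → Fin m) where

      IsTrail : Set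
      IsTrail = ∀ x → Joins E (f x) (w (inject₁ x)) (w (suc x))

      UsesBefore UsesFrom : Fin (suc s) → Fin m → Set
      UsesBefore y e = ∃[ x ] f x ≡ e × toℕ x < toℕ y
      UsesFrom   y e = ∃[ x ] f x ≡ e × toℕ y ≤ toℕ x

    trail-to : ∀ {s} w f → IsTrail {s} w f → ∀ y → Walk (AdjVia E (UsesBefore w f y)) (w zero) (w y)
    trail-to w f trail zero = here
    trail-to {suc s} w f trail (suc y) =
      step (f zero , (zero , refl , s≤s z≤n) , trail zero)
           (mapʷ shift (trail-to (λ z → w (suc z)) (λ x → f (suc x)) (λ x → trail (suc x)) y))
      where
      shift : ∀ {u v} → AdjVia E (UsesBefore (λ z → w (suc z)) (λ x → f (suc x)) y) u v → AdjVia E (UsesBefore w f (suc y)) u v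
      shift (e , (x , fx≡e , x<y) , j) = e , (suc x , fx≡e , s≤s x<y) , j

    trail-from : ∀ {s} w f → IsTrail {s} w f → ∀ y → Walk (AdjVia E (UsesFrom w f y)) (w y) (w (fromℕ s))
    trail-from {s} w f trail zero = mapʷ widen (trail-to w f trail (fromℕ s))
      where
      widen : ∀ {u v} → AdjVia E (UsesBefore w f (fromℕ s)) u v → AdjVia E (UsesFrom w f zero) u v
      widen (e , (x , fx≡e , _) , j) = e , (x , fx≡e , z≤n) , j
    trail-from {suc s} w f trail (suc y) =
      mapʷ shift (trail-from (λ z → w (suc z)) (λ x → f (suc x)) (λ x → trail (suc x)) y)
      where
      shift : ∀ {u v} → AdjVia E (UsesFrom (λ z → w (suc z)) (λ x → f (suc x)) y) u v → AdjVia E (UsesFrom w f (suc y)) u v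
      shift (e , (x , fx≡e , y≤x) , j) = e , (suc x , fx≡e , s≤s y≤x) , j

    AdjVia-mono : ∀ {P Q : Fin m → Set} → (∀ {e} → P e → Q e) → ∀ {u v} → AdjVia E P u v → AdjVia E Q u v
    AdjVia-mono P⇒Q (e , pe , j) = e , P⇒Q pe , j

    cycle-detour : (c : Cycle E) → ∀ i →
                   ∃[ a ] ∃[ b ] (Joins E (Cycle.es c i) a b × Walk (AdjVia E (_≢ Cycle.es c i)) b a)
    cycle-detour c i with last-or-inject₁ i
    ... | inj₁ refl = vs (fromℕ (suc j)) , vs zero , close ,
                      mapʷ (AdjVia-mono avoids-last) (trail-to vs f links (fromℕ (suc j)))
      where
      open Cycle c
      f = λ x → es (inject₁ x)
      avoids-last : ∀ {e} → UsesBefore vs f (fromℕ (suc j)) e → e ≢ es (fromℕ (suc j))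
      avoids-last (x , refl , _) eq = Fin.fromℕ≢inject₁ (sym (es-inj eq))
    ... | inj₂ (i′ , refl) = vs (inject₁ i′) , vs (suc i′) , links i′ ,
        (mapʷ (AdjVia-mono avoids-later) (trail-from vs f links (suc i′))
          ++ʷ step (es (fromℕ (suc j)) , (λ eq → Fin.fromℕ≢inject₁ (es-inj eq)) , close) here)
          ++ʷ mapʷ (AdjVia-mono avoids-earlier) (trail-to vs f links (inject₁ i′))
      where
      open Cycle c
      f = λ x → es (inject₁ x)
      avoids : ∀ {x} → toℕ x ≢ toℕ i′ → f x ≢ f i′
      avoids x≢i′ eq = x≢i′ (cong toℕ (Fin.inject₁-injective (es-inj eq)))
      avoids-later : ∀ {e} → UsesFrom vs f (suc i′) e → e ≢ f i′
      avoids-later (x , refl , i′<x) = avoids (λ x≡i′ → ℕ.<-irrefl (sym x≡i′) i′<x)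
      avoids-earlier : ∀ {e} → UsesBefore vs f (inject₁ i′) e → e ≢ f i′
      avoids-earlier (x , refl , x<i′) = avoids (λ x≡i′ → ℕ.<-irrefl (trans x≡i′ (sym (Fin.toℕ-inject₁ i′))) x<i′)

    cycles⇒bridgeless : (∀ e → Σ (Cycle E) (InCycle e)) → Bridgeless E
    cycles⇒bridgeless on-cycle e j with on-cycle e
    ... | c , i , refl with cycle-detour c i
    ...   | _ , _ , j′ , detour with Joins-unique j j′
    ...     | inj₁ (refl , refl) = reverseʷ AdjVia-sym detour
    ...     | inj₂ (refl , refl) = detour

    two-cut-connected : Connected E → Bridgeless E → ∀ {C o} → o ∉ C → cutE E C ≤ 2 →
                        ∀ {u v} → u ∈ C → v ∈ C → Walk (AdjWithin E C) u v
    -- Walk from u and from v towards o until C is left. The first exit edge of u has a detour,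
    -- which must leave C through a second edge; as at most two edges leave C, the exit edge
    -- of v is one of these two.
    two-cut-connected connected bridgeless {C} {o} o∉C cut≤2 {u} {v} u∈C v∈C =
      link-up (count≤2⇒≡⊎≡ cut≤2 (λ e₁≡e₃ → X₃.allowed (sym e₁≡e₃))
                             (crossing-of X₁) (crossing-of X₃) (crossing-of X₂))
      where
      toward-o : ∀ {x} → x ∈ C → Exit C (λ _ → ⊤) x
      toward-o {x} x∈C = exit (mapʷ (λ (e , j) → e , tt , j) (connected x o)) x∈C o∉C

      X₁ = toward-o u∈C
      X₂ = toward-o v∈C
      module X₁ = Exit X₁
      module X₂ = Exit X₂
      X₃ = exit (bridgeless X₁.edge X₁.joins) X₁.inner∈C X₁.outer∉C
      module X₃ = Exit X₃

      crossing-of : ∀ {P x} (X : Exit C P x) → crossesᵇ C (E (Exit.edge X)) ≡ true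
      crossing-of X = crossing (Exit.joins X) (Exit.inner∈C X) (Exit.outer∉C X)

      back-to-v : ∀ {P x} (X : Exit C P x) → X₂.edge ≡ Exit.edge X → Walk (AdjWithin E C) (Exit.inner X) v
      back-to-v X refl = subst (λ z → Walk (AdjWithin E C) z v)
        (crossing-inner-unique X₂.joins (Exit.joins X) X₂.inner∈C X₂.outer∉C (Exit.inner∈C X) (Exit.outer∉C X))
        (reverseʷ AdjWithin-sym X₂.path)

      link-up : X₂.edge ≡ X₁.edge ⊎ X₂.edge ≡ X₃.edge → Walk (AdjWithin E C) u v
      link-up (inj₁ e₂≡e₁) = X₁.path ++ʷ back-to-v X₁ e₂≡e₁
      link-up (inj₂ e₂≡e₃) = X₁.path ++ʷ (X₃.path ++ʷ back-to-v X₃ e₂≡e₃)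

module LaminarMaximum where

  open import Data.Fin.Subset using (Subset; _⊆_; _∩_; Nonempty)
  open import Data.List using (List; []; _∷_)
  open import Data.List.Relation.Unary.Any using (here; there)
  open import Data.List.Membership.Propositional using () renaming (_∈_ to _∈ˡ_)
  open import Data.Product using (_×_; _,_; ∃-syntax)
  open import Data.Sum using (_⊎_; inj₁; inj₂)
  open import Data.Empty using (⊥-elim)
  open import Relation.Nullary using (¬_; yes; no)
  open import Relation.Unary using (Decidable)
  open import Relation.Binary.PropositionalEquality using (refl)

  module _ {n} (P : Subset n → Set) where

    Greatest : List (Subset n) → Set
    Greatest 𝓛 = ∃[ C* ] (C* ∈ˡ 𝓛 × P C* × (∀ {C} → C ∈ˡ 𝓛 → P C → C ⊆ C*))

    Meeting : List (Subset n) → Set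
    Meeting 𝓛 = ∀ {C D} → C ∈ˡ 𝓛 → D ∈ˡ 𝓛 → P C → P D → Nonempty (C ∩ D)

  module _ {n} {P : Subset n → Set} (P? : Decidable P) where

    greatest? : ∀ {𝓛} → Laminar 𝓛 → Meeting P 𝓛 → (∀ {C} → C ∈ˡ 𝓛 → ¬ P C) ⊎ Greatest P 𝓛
    greatest? {[]} _ _ = inj₁ (λ ())
    greatest? {D ∷ 𝓛} laminar meeting
      with P? D | greatest? (λ A B A∈ B∈ → laminar A B (there A∈) (there B∈))
                            (λ C∈ D∈ → meeting (there C∈) (there D∈))
    ... | no ¬PD | inj₁ none = inj₁ λ { (here refl) → ¬PD ; (there C∈) → none C∈ }
    ... | no ¬PD | inj₂ (C* , C*∈ , PC* , above) =
      inj₂ (C* , there C*∈ , PC* , λ { (here refl) PD → ⊥-elim (¬PD PD) ; (there C∈) → above C∈ })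
    ... | yes PD | inj₁ none =
      inj₂ (D , here refl , PD , λ { (here refl) _ → λ x∈ → x∈ ; (there C∈) PC → ⊥-elim (none C∈ PC) })
    ... | yes PD | inj₂ (C* , C*∈ , PC* , above) with laminar D C* (here refl) (there C*∈)
    ...   | inj₁ disjoint = ⊥-elim (disjoint (meeting (here refl) (there C*∈) PD PC*))
    ...   | inj₂ (inj₁ D⊆C*) =
      inj₂ (C* , there C*∈ , PC* , λ { (here refl) _ → D⊆C* ; (there C∈) → above C∈ })
    ...   | inj₂ (inj₂ C*⊆D) =
      inj₂ (D , here refl , PD , λ { (here refl) _ → λ x∈ → x∈ ; (there C∈) PC → λ x∈ → C*⊆D (above C∈ PC x∈) })

module ArcVector where

  open import Data.Nat using (ℕ; _+_; _*_)
  open import Data.Nat.Properties using (*-distribˡ-+; *-zeroʳ; +-identityʳ; +-commutativeSemigroup; *-commutativeSemigroup)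
  open import Algebra.Properties.CommutativeSemigroup +-commutativeSemigroup using (interchange)
  open import Algebra.Properties.CommutativeSemigroup *-commutativeSemigroup using (x∙yz≈y∙xz)
  open import Data.Bool using (Bool; true; false; _∧_)
  import Data.Bool.Properties as Bool
  open import Data.Fin using (Fin; _≟_)
  open import Data.Maybe using (Maybe; just; nothing; maybe′)
  open import Data.Product using (_×_; _,_)
  open import Relation.Nullary using (does)
  open import Relation.Binary.PropositionalEquality
  open NatSum

  Arc : ℕ → Set
  Arc k = Fin k × Bool

  ⟪_,_⟫ : ∀ {k} → (Arc k → ℕ) → (Arc k → ℕ) → ℕ
  ⟪ g , y ⟫ = sum (λ i → g (i , true) * y (i , true) + g (i , false) * y (i , false))

  ⟪⟫-+ : ∀ {k} (g y z : Arc k → ℕ) → ⟪ g , (λ a → y a + z a) ⟫ ≡ ⟪ g , y ⟫ + ⟪ g , z ⟫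
  ⟪⟫-+ {k} g y z = trans (sum-cong-≗ {k} pointwise) (∑-distrib-+ (pairing y) (pairing z))
    where
    pairing : (Arc k → ℕ) → Fin k → ℕ
    pairing x i = g (i , true) * x (i , true) + g (i , false) * x (i , false)
    pointwise : ∀ i → pairing (λ a → y a + z a) i ≡ pairing y i + pairing z i
    pointwise i = trans (cong₂ _+_ (*-distribˡ-+ (g (i , true)) (y (i , true)) (z (i , true)))
                                   (*-distribˡ-+ (g (i , false)) (y (i , false)) (z (i , false))))
                        (interchange (g (i , true) * y (i , true)) (g (i , true) * z (i , true)) _ _)

  ⟪⟫-sum : ∀ {k p} (g : Arc k → ℕ) (w : Fin p → ℕ) (y : Fin p → Arc k → ℕ) →
           ⟪ g , (λ a → sum (λ c → w c * y c a)) ⟫ ≡ sum (λ c → w c * ⟪ g , y c ⟫)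
  ⟪⟫-sum {k} {p} g w y = begin
    sum (λ i → g (i , true) * sum (λ c → w c * y c (i , true)) + g (i , false) * sum (λ c → w c * y c (i , false)))
      ≡⟨ sum-cong-≗ {k} (λ i → trans (distribute i) (sym (∑-distrib-+ (term-true i) (term-false i)))) ⟩
    sum (λ i → sum (λ c → term c i))
      ≡⟨ ∑-comm (λ i c → term c i) ⟩
    sum (λ c → sum (λ i → term c i))
      ≡⟨ sum-cong-≗ {p} (λ c → trans (sum-cong-≗ {k} (factor-out c)) (sym (*-distribˡ-sum (w c) (pairing c)))) ⟩
    sum (λ c → w c * ⟪ g , y c ⟫) ∎
    where
    open ≡-Reasoning
    term-true term-false : Fin k → Fin p → ℕ
    term-true  i c = g (i , true) * (w c * y c (i , true))
    term-false i c = g (i , false) * (w c * y c (i , false))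
    term : Fin p → Fin k → ℕ
    term c i = term-true i c + term-false i c
    pairing : Fin p → Fin k → ℕ
    pairing c i = g (i , true) * y c (i , true) + g (i , false) * y c (i , false)
    distribute : ∀ i → g (i , true) * sum (λ c → w c * y c (i , true)) + g (i , false) * sum (λ c → w c * y c (i , false))
                       ≡ sum (term-true i) + sum (term-false i)
    distribute i = cong₂ _+_ (*-distribˡ-sum (g (i , true)) (λ c → w c * y c (i , true)))
                             (*-distribˡ-sum (g (i , false)) (λ c → w c * y c (i , false)))
    factor-out : ∀ c i → term c i ≡ w c * pairing c i
    factor-out c i = trans (cong₂ _+_ (x∙yz≈y∙xz (g (i , true)) (w c) (y c (i , true)))
                                      (x∙yz≈y∙xz (g (i , false)) (w c) (y c (i , false))))
                           (sym (*-distribˡ-+ (w c) (g (i , true) * y c (i , true)) (g (i , false) * y c (i , false))))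

  unit : ∀ {k} → Maybe (Arc k) → Arc k → ℕ
  unit nothing        _       = 0
  unit (just (j , e)) (i , d) = 𝟙 (does (d Bool.≟ e) ∧ does (i ≟ j))

  ⟪⟫-unit : ∀ {k} (g : Arc k → ℕ) (α : Maybe (Arc k)) → ⟪ g , unit α ⟫ ≡ maybe′ g 0 α
  ⟪⟫-unit {k} g nothing =
    trans (sum-cong-≗ {k} (λ i → cong₂ _+_ (*-zeroʳ (g (i , true))) (*-zeroʳ (g (i , false))))) (sum-replicate-zero k)
  ⟪⟫-unit {k} g (just (j , true)) =
    trans (sum-cong-≗ {k} (λ i → trans (cong (λ z → g (i , true) * 𝟙 (does (i ≟ j)) + z) (*-zeroʳ (g (i , false))))
                                       (+-identityʳ (g (i , true) * 𝟙 (does (i ≟ j))))))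
          (sum-select (λ i → g (i , true)) j)
  ⟪⟫-unit {k} g (just (j , false)) =
    trans (sum-cong-≗ {k} (λ i → cong (λ z → z + g (i , false) * 𝟙 (does (i ≟ j))) (*-zeroʳ (g (i , true)))))
          (sum-select (λ i → g (i , false)) j)

  ⟪⟫-load : ∀ {k p} (g : Arc k → ℕ) (w : Fin p → ℕ) (α : Fin p → Maybe (Arc k)) →
            ⟪ g , (λ a → sum (λ c → w c * unit (α c) a)) ⟫ ≡ sum (λ c → w c * maybe′ g 0 (α c))
  ⟪⟫-load {p = p} g w α =
    trans (⟪⟫-sum g w (λ c → unit (α c))) (sum-cong-≗ {p} (λ c → cong (w c *_) (⟪⟫-unit g (α c))))

module LinkCovering where

  open import Data.Bool using (true; false)
  open import Data.Fin using (Fin; _≟_)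
  open import Data.Fin.Subset using (Subset; _∈_; _∉_)
  open import Data.Vec using (lookup)
  open import Data.Product using (_×_; _,_; proj₁; proj₂; ∃-syntax)
  open import Data.Sum using (_⊎_; inj₁; inj₂)
  open import Data.Empty using (⊥-elim)
  open import Relation.Nullary using (¬_; Dec)
  open import Relation.Nullary.Decidable using (_⊎-dec_)
  open import Relation.Binary.PropositionalEquality
  open Membership

  Endpoint : ∀ {n} → Fin n → Fin n × Fin n → Set
  Endpoint t ℓ = proj₁ ℓ ≡ t ⊎ proj₂ ℓ ≡ t

  endpoint? : ∀ {n} t (ℓ : Fin n × Fin n) → Dec (Endpoint t ℓ)
  endpoint? t ℓ = (proj₁ ℓ ≟ t) ⊎-dec (proj₂ ℓ ≟ t)

  module _ {n} {C : Subset n} {ℓ : Fin n × Fin n} where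

    covered-ends-differ : Covers ℓ C → lookup C (proj₁ ℓ) ≢ lookup C (proj₂ ℓ)
    covered-ends-differ cov same with lookup C (proj₁ ℓ) | lookup C (proj₂ ℓ)
    covered-ends-differ () refl | true  | true
    covered-ends-differ () refl | false | false

    covered-in₁⇒out₂ : Covers ℓ C → proj₁ ℓ ∈ C → proj₂ ℓ ∉ C
    covered-in₁⇒out₂ cov p₁∈C p₂∈C = covered-ends-differ cov (trans (∈⇒lookup p₁∈C) (sym (∈⇒lookup p₂∈C)))

    covered-in₂⇒out₁ : Covers ℓ C → proj₂ ℓ ∈ C → proj₁ ℓ ∉ C
    covered-in₂⇒out₁ cov p₂∈C p₁∈C = covered-ends-differ cov (trans (∈⇒lookup p₁∈C) (sym (∈⇒lookup p₂∈C)))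

    covered⇒end-in : Covers ℓ C → ∃[ t ] Endpoint t ℓ × t ∈ C
    covered⇒end-in cov with lookup C (proj₁ ℓ) in p₁ | lookup C (proj₂ ℓ) in p₂
    ... | true  | _    = proj₁ ℓ , inj₁ refl , lookup⇒∈ p₁
    ... | false | true = proj₂ ℓ , inj₂ refl , lookup⇒∈ p₂
    covered⇒end-in () | false | false

    uncovered-ends-agree : ¬ Covers ℓ C → lookup C (proj₁ ℓ) ≡ lookup C (proj₂ ℓ)
    uncovered-ends-agree ¬cov with lookup C (proj₁ ℓ) | lookup C (proj₂ ℓ)
    ... | true  | true  = refl
    ... | false | false = refl
    ... | true  | false = ⊥-elim (¬cov refl)
    ... | false | true  = ⊥-elim (¬cov refl)

    uncovered-end-in⇒ends-in : ¬ Covers ℓ C → ∀ {t} → Endpoint t ℓ → t ∈ C → proj₁ ℓ ∈ C × proj₂ ℓ ∈ C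
    uncovered-end-in⇒ends-in ¬cov (inj₁ refl) t∈C =
      t∈C , lookup⇒∈ (trans (sym (uncovered-ends-agree ¬cov)) (∈⇒lookup t∈C))
    uncovered-end-in⇒ends-in ¬cov (inj₂ refl) t∈C =
      lookup⇒∈ (trans (uncovered-ends-agree ¬cov) (∈⇒lookup t∈C)) , t∈C

module Matching where

  open import Data.Nat using (zero; suc; _+_; _*_)
  open import Data.Nat.Properties using (*-suc)
  open import Data.Bool using (Bool; true; false; _∧_; _∨_)
  open import Data.Fin using (Fin; zero; suc)
  open import Data.Fin.Properties using (suc-injective)
  open import Data.Fin.Subset using (Subset; _∈_; ∣_∣)
  open import Data.Vec using ([]; _∷_; here; there)
  open import Data.Product using (_×_; _,_; proj₁; proj₂; ∃-syntax)
  open import Data.Sum using (inj₁; inj₂)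
  open import Data.Empty using (⊥-elim)
  open import Relation.Nullary using (¬_; does)
  open import Relation.Binary.PropositionalEquality
  open Counting using (count-∨; count-pair; count-false; does⇒; ∨-true⇒⊎)
  open LinkCovering using (Endpoint; endpoint?)

  coveredᵇ : ∀ {n k} → Links n k → Subset k → Fin n → Bool
  coveredᵇ {k = zero}  L []      t = false
  coveredᵇ {k = suc k} L (b ∷ M) t = (b ∧ does (endpoint? t (L zero))) ∨ coveredᵇ (λ i → L (suc i)) M t

  coveredᵇ-sound : ∀ {n k} (L : Links n k) (M : Subset k) {t} → coveredᵇ L M t ≡ true →
                   ∃[ i ] i ∈ M × Endpoint t (L i)
  coveredᵇ-sound {k = suc k} L (true ∷ M) {t} covered with ∨-true⇒⊎ (does (endpoint? t (L zero))) covered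
  ... | inj₁ end₀ = zero , here , does⇒ (endpoint? t (L zero)) end₀
  ... | inj₂ rest = later (coveredᵇ-sound (λ i → L (suc i)) M rest)
    where later = λ (i , i∈M , end) → suc i , there i∈M , end
  coveredᵇ-sound {k = suc k} L (false ∷ M) covered = later (coveredᵇ-sound (λ i → L (suc i)) M covered)
    where later = λ (i , i∈M , end) → suc i , there i∈M , end

  PairwiseDisjoint : ∀ {n k} → Links n k → Subset k → Set
  PairwiseDisjoint L M = ∀ i j → i ∈ M → j ∈ M → i ≢ j → ∀ t → Endpoint t (L i) → ¬ Endpoint t (L j)

  PairwiseDisjoint-tail : ∀ {n k} {L : Links n (suc k)} {b M} → PairwiseDisjoint L (b ∷ M) →
                          PairwiseDisjoint (λ i → L (suc i)) M
  PairwiseDisjoint-tail disjoint i j i∈M j∈M i≢j =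
    disjoint (suc i) (suc j) (there i∈M) (there j∈M) (λ eq → i≢j (suc-injective eq))

  count-covered : ∀ {n k} (L : Links n k) (M : Subset k) → (∀ i → proj₁ (L i) ≢ proj₂ (L i)) →
                  PairwiseDisjoint L M → count (coveredᵇ L M) ≡ 2 * ∣ M ∣
  count-covered {n} {zero} L [] _ _ = count-false {n}
  count-covered {k = suc k} L (false ∷ M) proper disjoint =
    count-covered (λ i → L (suc i)) M (λ i → proper (suc i)) (PairwiseDisjoint-tail disjoint)
  count-covered {k = suc k} L (true ∷ M) proper disjoint = begin
    count (λ t → does (endpoint? t (L zero)) ∨ coveredᵇ L′ M t)       ≡⟨ count-∨ first-apart ⟩
    count (λ t → does (endpoint? t (L zero))) + count (coveredᵇ L′ M)  ≡⟨ cong₂ _+_ (count-pair (proper zero)) rest ⟩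
    2 + 2 * ∣ M ∣                                                      ≡⟨ *-suc 2 ∣ M ∣ ⟨
    2 * suc ∣ M ∣                                                      ∎
    where
    open ≡-Reasoning
    L′ = λ i → L (suc i)
    rest = count-covered L′ M (λ i → proper (suc i)) (PairwiseDisjoint-tail disjoint)
    first-apart : ∀ t → does (endpoint? t (L zero)) ≡ true → coveredᵇ L′ M t ≡ false
    first-apart t end₀ with coveredᵇ L′ M t in covered
    ... | false = refl
    ... | true  = let i , i∈M , end = coveredᵇ-sound L′ M covered in
                  ⊥-elim (disjoint zero (suc i) here (there i∈M) (λ ()) t (does⇒ (endpoint? t (L zero)) end₀) end)

module Instance {n m k} (E : Edges n m) (L : Links n k) (r : Fin n) where

  open import Data.Nat as ℕ using (ℕ; _+_; _≤_; _<_; s≤s; z≤n)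
  import Data.Nat.Properties as ℕ
  open import Data.Bool using (Bool; true; false; _∧_; not)
  import Data.Bool.Properties as Bool
  open import Data.Fin.Subset using (Subset; _∈_; _∉_; _⊆_)
  open import Data.Fin.Subset.Properties using (_∈?_; _⊆?_; x∈p∩q⁺)
  open import Data.Fin.Properties using (any?)
  open import Data.List.Membership.Propositional using () renaming (_∈_ to _∈ˡ_)
  open import Data.Maybe using (Maybe; just; nothing; maybe′)
  open import Data.Product using (_×_; _,_; proj₁; proj₂; ∃-syntax)
  open import Data.Sum using (_⊎_; inj₁; inj₂)
  open import Data.Empty using (⊥-elim)
  open import Relation.Nullary using (Dec)
  open import Relation.Nullary.Decidable using (_×-dec_)
  open import Relation.Binary.PropositionalEquality
  open import Data.Rational as ℚ using (ℚ; 1ℚ)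
  open Membership
  open Counting using (count-pos)
  open NatSum using (𝟙)
  open Half using (half; half-if; half-+; sumℚ-half; half-mono-≤; 0≤half)
  open Graph using (mapʷ; two-cut-connected; cycles⇒bridgeless)
  open LinkCovering
  open ArcVector using (Arc; ⟪_,_⟫)
  open LaminarMaximum using (Meeting; greatest?)

  end-root-or-leaf : LeafToLeafPlus E L r → ∀ {i t} → Endpoint t (L i) → t ≡ r ⊎ IsLeaf E t
  end-root-or-leaf l2l {i} (inj₁ refl) = proj₁ (l2l i)
  end-root-or-leaf l2l {i} (inj₂ refl) = proj₂ (l2l i)

  end-is-leaf : LeafToLeafPlus E L r → ∀ {C} → r ∉ C → ∀ {i t} → Endpoint t (L i) → t ∈ C → IsLeaf E t
  end-is-leaf l2l r∉C end t∈C with end-root-or-leaf l2l end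
  ... | inj₁ refl = ⊥-elim (r∉C t∈C)
  ... | inj₂ leaf = leaf

  two-cut-nonempty : ∀ {C} → cutE E C ≡ 2 → ∃[ x ] x ∈ C
  two-cut-nonempty {C} cut≡2 with e , crosses ← count-pos {p = λ e → crossesᵇ C (E e)} (subst (0 <_) (sym cut≡2) (s≤s z≤n))
                             with x , _ , x∈C ← covered⇒end-in {C = C} {ℓ = E e} crosses = x , x∈C

  covering-link : Feasible E L → ∀ {C} → InFamC E r C → ∃[ i ] Covers (L i) C
  covering-link feasible {C} (r∉C , cut≡2) = count-pos {p = λ i → crossesᵇ C (L i)} links-cross
    where
    links-cross : 1 ≤ cutL L C
    links-cross = ℕ.+-cancelˡ-≤ 2 1 (cutL L C)
      (subst (λ c → 3 ≤ c + cutL L C) cut≡2 (feasible C (two-cut-nonempty cut≡2) (r , r∉C)))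

  terminal-exists : Feasible E L → LeafToLeafPlus E L r → ∀ {C} → InFamC E r C → ∃[ t ] InTC E L C t
  terminal-exists feasible l2l {C} C∈𝒞@(r∉C , _) with i , covers ← covering-link feasible C∈𝒞
                                              with t , end , t∈C ← covered⇒end-in {C = C} {ℓ = L i} covers =
    t , t∈C , end-is-leaf l2l r∉C end t∈C , i , covers , end

  inside-two-cut⇒InLink : IsCactus E → ∀ {C} → InFamC E r C → ∀ {u v} → u ∈ C → v ∈ C → InLink E r (u , v)
  inside-two-cut⇒InLink (connected , on-cycle) {C} (r∉C , cut≡2) u∈C v∈C =
    avoids-r u∈C , avoids-r v∈C ,
    mapʷ (λ (adj , x∈C , y∈C) → adj , avoids-r x∈C , avoids-r y∈C)
         (two-cut-connected connected bridgeless r∉C (ℕ.≤-reflexive cut≡2) u∈C v∈C)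
    where
    bridgeless = cycles⇒bridgeless (λ e → proj₁ (on-cycle e))
    avoids-r : ∀ {x} → x ∈ C → x ≢ r
    avoids-r x∈C refl = r∉C x∈C

  InTC? : ∀ C t → Dec (InTC E L C t)
  InTC? C t = (t ∈? C) ×-dec (deg E t ℕ.≟ 2) ×-dec any? (λ i → (crossesᵇ C (L i) Bool.≟ true) ×-dec endpoint? t (L i))

  -- (i , true) is the arc proj₁ (L i) → proj₂ (L i), whose LP value is xf i in Defs.inflow;
  -- (i , false) is the reverse arc, with value xb i.
  enters : Subset n → Arc k → Bool
  enters C (i , true)  = not (inᵇ C (proj₁ (L i))) ∧ inᵇ C (proj₂ (L i))
  enters C (i , false) = not (inᵇ C (proj₂ (L i))) ∧ inᵇ C (proj₁ (L i))

  entering : Subset n → Arc k → ℕ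
  entering C a = 𝟙 (enters C a)

  arc-into : ∀ {C t} → InTC E L C t → Arc k
  arc-into (_ , _ , i , _ , inj₁ _) = i , false
  arc-into (_ , _ , i , _ , inj₂ _) = i , true

  arc-into-enters : ∀ {C* C t} (t∈T : InTC E L C* t) → C ⊆ C* → t ∈ C → enters C (arc-into t∈T) ≡ true
  arc-into-enters {C = C} (t∈C* , _ , i , covers , inj₁ refl) C⊆C* t∈C
    rewrite ∈⇒lookup t∈C | ∉⇒lookup {C = C} (λ other∈C → covered-in₁⇒out₂ covers t∈C* (C⊆C* other∈C)) = refl
  arc-into-enters {C = C} (t∈C* , _ , i , covers , inj₂ refl) C⊆C* t∈C
    rewrite ∈⇒lookup t∈C | ∉⇒lookup {C = C} (λ other∈C → covered-in₂⇒out₁ covers t∈C* (C⊆C* other∈C)) = refl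

  module _ (y : Arc k → ℕ) where

    xᶠ xᵇ : Fin k → ℚ
    xᶠ i = half (y (i , true))
    xᵇ i = half (y (i , false))

    inflow-half : ∀ C → inflow L xᶠ xᵇ C ≡ half ⟪ entering C , y ⟫
    inflow-half C = sumℚ-half λ i →
      trans (cong₂ ℚ._+_ (half-if (enters C (i , true)) (y (i , true)))
                                     (half-if (enters C (i , false)) (y (i , false))))
            (sym (half-+ (𝟙 (enters C (i , true)) ℕ.* y (i , true)) (𝟙 (enters C (i , false)) ℕ.* y (i , false))))

    total-half : total xᶠ xᵇ ≡ half ⟪ (λ _ → 1) , y ⟫
    total-half = sumℚ-half λ i →
      trans (sym (half-+ (y (i , true)) (y (i , false))))
            (cong half (sym (cong₂ _+_ (ℕ.+-identityʳ (y (i , true))) (ℕ.+-identityʳ (y (i , false))))))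

    halved-feasible : ∀ 𝓛 → (∀ {C} → C ∈ˡ 𝓛 → 2 ≤ ⟪ entering C , y ⟫) → LPFeasible L 𝓛 xᶠ xᵇ
    halved-feasible 𝓛 two≤ =
      (λ i → 0≤half (y (i , true))) , (λ i → 0≤half (y (i , false))) ,
      (λ C C∈𝓛 → subst (1ℚ ℚ.≤_) (sym (inflow-half C)) (half-mono-≤ (two≤ C∈𝓛)))

  module ArcChoice (𝓛 : List (Subset n)) (laminar : Laminar 𝓛) where

    Anchors : Subset n → Subset n → Set
    Anchors Q C = (∃[ t ] t ∈ Q × InTC E L C t) × Q ⊆ C

    anchors? : ∀ Q C → Dec (Anchors Q C)
    anchors? Q C = any? (λ t → (t ∈? Q) ×-dec InTC? C t) ×-dec (Q ⊆? C)

    anchored-meet : ∀ Q → Meeting (Anchors Q) 𝓛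
    anchored-meet Q _ _ ((t , t∈Q , t∈T) , _) (_ , Q⊆D) = t , x∈p∩q⁺ (proj₁ t∈T , Q⊆D t∈Q)

    -- The members of 𝓛 anchored by Q form a chain; the arc is chosen at its top.
    entering-arc : Subset n → Maybe (Arc k)
    entering-arc Q with greatest? (anchors? Q) laminar (anchored-meet Q)
    ... | inj₁ _                                   = nothing
    ... | inj₂ (_ , _ , ((_ , _ , t∈T) , _) , _) = just (arc-into t∈T)

    entering-arc-enters : ∀ {Q C} → C ∈ˡ 𝓛 → Anchors Q C → maybe′ (entering C) 0 (entering-arc Q) ≡ 1
    entering-arc-enters {Q} {C} C∈𝓛 anchored with greatest? (anchors? Q) laminar (anchored-meet Q)
    ... | inj₁ unanchored = ⊥-elim (unanchored C∈𝓛 anchored)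
    ... | inj₂ (_ , _ , ((t , t∈Q , t∈T) , _) , above)
      rewrite arc-into-enters t∈T (above C∈𝓛 anchored) (proj₂ anchored t∈Q) = refl

module FractionalPoint {n m k} (E : Edges n m) (L : Links n k) (r : Fin n)
  (cactus : IsCactus E) (link-set : IsLinkSet L) (feasible : Feasible E L) (leaf-to-leaf : LeafToLeafPlus E L r)
  (M : Subset k) (matching : IsLeafMatching E L M) (no-bad : ∀ i → i ∈ M → ¬ Bad E L r (L i))
  (Min : Subset k) (Min-spec : ∀ i → (i ∈ Min → i ∈ M × InLink E r (L i)) × (i ∈ M × InLink E r (L i) → i ∈ Min))
  (𝓛 : List (Subset n)) (𝓛⊆𝒞ᴹ : All (InFamCM E L r M) 𝓛) (laminar : Laminar 𝓛) where

  open import Data.Nat as ℕ using (ℕ; _+_; _*_; _≤_; _∸_; z≤n)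
  import Data.Nat.Properties as ℕ
  open import Data.Bool using (Bool; true; false; _∧_; _∨_; not; if_then_else_)
  import Data.Bool.Properties as Bool
  open import Data.Fin.Subset using (_⊆_; _∪_; ⁅_⁆; ∣_∣)
  open import Data.Fin.Subset.Properties using (_∈?_; x∈⁅x⁆; x∈⁅y⁆⇒x≡y; x∈p∪q⁺; x∈p∪q⁻)
  open import Data.Fin.Properties using (any?)
  open import Data.List.Membership.Propositional using () renaming (_∈_ to _∈ˡ_)
  import Data.List.Relation.Unary.All as All
  open import Data.Maybe using (Maybe; just; nothing; maybe′)
  open import Data.Product using (_,_; proj₁; proj₂; ∃-syntax)
  open import Data.Sum using (_⊎_; inj₁; inj₂)
  open import Data.Empty using (⊥-elim)
  open import Relation.Nullary using (does; yes; no)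
  open import Relation.Nullary.Decidable using (dec-true; _×-dec_; ¬?)
  open import Relation.Binary.PropositionalEquality
  open Counting using (count-∨; count-mono)
  open NatSum
  open LinkCovering using (Endpoint; endpoint?; uncovered-end-in⇒ends-in)
  open Matching using (coveredᵇ; coveredᵇ-sound; count-covered)
  open ArcVector
  open Instance E L r
  open ArcChoice 𝓛 laminar

  unmatchedᵇ : Fin n → Bool
  unmatchedᵇ t = isLeafᵇ E t ∧ not (coveredᵇ L M t)

  ends : Fin n × Fin n → Subset n
  ends ℓ = ⁅ proj₁ ℓ ⁆ ∪ ⁅ proj₂ ℓ ⁆

  leaf-arc : Fin n → Maybe (Arc k)
  leaf-arc t = if unmatchedᵇ t then entering-arc ⁅ t ⁆ else nothing

  link-arc : Fin k → Maybe (Arc k)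
  link-arc i = if does (i ∈? Min) then entering-arc (ends (L i)) else nothing

  twice-x : Arc k → ℕ
  twice-x a = sum (λ t → 2 * unit (leaf-arc t) a) + sum (λ i → 1 * unit (link-arc i) a)

  ⟪⟫-twice-x : ∀ g → ⟪ g , twice-x ⟫ ≡ sum (λ t → 2 * maybe′ g 0 (leaf-arc t)) + sum (λ i → 1 * maybe′ g 0 (link-arc i))
  ⟪⟫-twice-x g = trans (⟪⟫-+ g (λ a → sum (λ t → 2 * unit (leaf-arc t) a)) (λ a → sum (λ i → 1 * unit (link-arc i) a)))
                 (cong₂ _+_ (⟪⟫-load g (λ _ → 2) leaf-arc) (⟪⟫-load g (λ _ → 1) link-arc))

  optional-arc≤ : ∀ b (α : Maybe (Arc k)) → maybe′ (λ _ → 1) 0 (if b then α else nothing) ≤ 𝟙 b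
  optional-arc≤ true  (just _) = ℕ.≤-refl
  optional-arc≤ true  nothing  = z≤n
  optional-arc≤ false _        = z≤n

  value-bound : ⟪ (λ _ → 1) , twice-x ⟫ ≤ ∣ Min ∣ + 2 * count unmatchedᵇ
  value-bound = begin
    ⟪ (λ _ → 1) , twice-x ⟫
      ≡⟨ ⟪⟫-twice-x (λ _ → 1) ⟩
    sum (λ t → 2 * maybe′ (λ _ → 1) 0 (leaf-arc t)) + sum (λ i → 1 * maybe′ (λ _ → 1) 0 (link-arc i))
      ≤⟨ ℕ.+-mono-≤ (sum-mono-≤ (λ t → ℕ.*-monoʳ-≤ 2 (optional-arc≤ (unmatchedᵇ t) _)))
                    (sum-mono-≤ (λ i → ℕ.*-monoʳ-≤ 1 (optional-arc≤ (does (i ∈? Min)) _))) ⟩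
    sum (λ t → 2 * 𝟙 (unmatchedᵇ t)) + sum (λ i → 1 * 𝟙 (does (i ∈? Min)))
      ≡⟨ cong₂ _+_ (sym (*-distribˡ-sum 2 (λ t → 𝟙 (unmatchedᵇ t))))
                   (sum-cong-≗ {k} (λ i → ℕ.*-identityˡ (𝟙 (does (i ∈? Min))))) ⟩
    2 * sum (λ t → 𝟙 (unmatchedᵇ t)) + sum (λ i → 𝟙 (does (i ∈? Min)))
      ≡⟨ cong₂ _+_ (cong (2 *_) (count≡sum unmatchedᵇ)) (trans (∣∣≡count Min) (count≡sum (λ i → does (i ∈? Min)))) ⟨
    2 * count unmatchedᵇ + ∣ Min ∣
      ≡⟨ ℕ.+-comm (2 * count unmatchedᵇ) ∣ Min ∣ ⟩
    ∣ Min ∣ + 2 * count unmatchedᵇ ∎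
    where open ℕ.≤-Reasoning

  unmatched-bound : count unmatchedᵇ + 2 * ∣ M ∣ ≤ numLeaves E
  unmatched-bound = begin
    count unmatchedᵇ + 2 * ∣ M ∣
      ≡⟨ cong (count unmatchedᵇ +_) (count-covered L M (proj₁ link-set) (proj₂ matching)) ⟨
    count unmatchedᵇ + count (coveredᵇ L M)
      ≡⟨ count-∨ unmatched⇒uncovered ⟨
    count (λ t → unmatchedᵇ t ∨ coveredᵇ L M t)
      ≤⟨ count-mono either⇒leaf ⟩
    numLeaves E ∎
    where
    open ℕ.≤-Reasoning
    unmatched⇒uncovered : ∀ t → unmatchedᵇ t ≡ true → coveredᵇ L M t ≡ false
    unmatched⇒uncovered t unmatched =
      trans (sym (Bool.not-involutive _)) (cong not (Bool.∧-conicalʳ (isLeafᵇ E t) _ unmatched))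
    either⇒leaf : ∀ t → unmatchedᵇ t ∨ coveredᵇ L M t ≡ true → isLeafᵇ E t ≡ true
    either⇒leaf t either with Counting.∨-true⇒⊎ (unmatchedᵇ t) either
    ... | inj₁ unmatched = Bool.∧-conicalˡ (isLeafᵇ E t) _ unmatched
    ... | inj₂ covered with i , i∈M , end ← coveredᵇ-sound L M covered =
      dec-true (deg E t ℕ.≟ 2) (end-leaf (proj₁ matching i i∈M) end)
      where
      end-leaf : ∀ {ℓ} → IsLeaf E (proj₁ ℓ) × IsLeaf E (proj₂ ℓ) → Endpoint t ℓ → IsLeaf E t
      end-leaf (leaf₁ , _) (inj₁ refl) = leaf₁
      end-leaf (_ , leaf₂) (inj₂ refl) = leaf₂

  in-𝒞ᴹ : ∀ {C} → C ∈ˡ 𝓛 → InFamCM E L r M C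
  in-𝒞ᴹ = All.lookup 𝓛⊆𝒞ᴹ

  end∈ends : ∀ {t ℓ} → Endpoint t ℓ → t ∈ ends ℓ
  end∈ends (inj₁ refl) = x∈p∪q⁺ (inj₁ (x∈⁅x⁆ _))
  end∈ends (inj₂ refl) = x∈p∪q⁺ (inj₂ (x∈⁅x⁆ _))

  ends⊆ : ∀ {C ℓ} → proj₁ ℓ ∈ C × proj₂ ℓ ∈ C → ends ℓ ⊆ C
  ends⊆ {C} {ℓ} (p₁∈C , p₂∈C) x∈ends with x∈p∪q⁻ ⁅ proj₁ ℓ ⁆ ⁅ proj₂ ℓ ⁆ x∈ends
  ... | inj₁ x∈⁅p₁⁆ = subst (_∈ C) (sym (x∈⁅y⁆⇒x≡y _ x∈⁅p₁⁆)) p₁∈C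
  ... | inj₂ x∈⁅p₂⁆ = subst (_∈ C) (sym (x∈⁅y⁆⇒x≡y _ x∈⁅p₂⁆)) p₂∈C

  leaf-arc-enters : ∀ {C t} → C ∈ˡ 𝓛 → InTC E L C t → unmatchedᵇ t ≡ true → maybe′ (entering C) 0 (leaf-arc t) ≡ 1
  leaf-arc-enters {C} {t} C∈𝓛 t∈T unmatched rewrite unmatched =
    entering-arc-enters C∈𝓛 ((t , x∈⁅x⁆ t , t∈T) , λ x∈⁅t⁆ → subst (_∈ C) (sym (x∈⁅y⁆⇒x≡y t x∈⁅t⁆)) (proj₁ t∈T))

  ends-in⇒InLink : ∀ {C} → C ∈ˡ 𝓛 → ∀ {ℓ} → proj₁ ℓ ∈ C × proj₂ ℓ ∈ C → InLink E r ℓ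
  ends-in⇒InLink C∈𝓛 (p₁∈C , p₂∈C) = inside-two-cut⇒InLink cactus (proj₁ (in-𝒞ᴹ C∈𝓛)) p₁∈C p₂∈C

  link-arc-enters : ∀ {C} → C ∈ˡ 𝓛 → ∀ {i t} → i ∈ M → InTC E L C t → Endpoint t (L i) →
                    maybe′ (entering C) 0 (link-arc i) ≡ 1
  link-arc-enters {C} C∈𝓛 {i} {t} i∈M t∈T end
    with ends-in ← uncovered-end-in⇒ends-in (proj₂ (in-𝒞ᴹ C∈𝓛) i i∈M) end (proj₁ t∈T)
    rewrite dec-true (i ∈? Min) (proj₂ (Min-spec i) (i∈M , ends-in⇒InLink C∈𝓛 ends-in)) =
    entering-arc-enters C∈𝓛 ((t , end∈ends end , t∈T) , ends⊆ ends-in)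

  matched-terminal : ∀ {C t} → InTC E L C t → unmatchedᵇ t ≢ true → ∃[ i ] i ∈ M × Endpoint t (L i)
  matched-terminal {t = t} (_ , leaf , _) not-unmatched with coveredᵇ L M t in covered
  ... | true  = coveredᵇ-sound L M covered
  ... | false = ⊥-elim (not-unmatched (cong (_∧ true) (dec-true (deg E t ℕ.≟ 2) leaf)))

  two-link-arcs : ∀ {C} → C ∈ˡ 𝓛 → (∀ t → InTC E L C t → unmatchedᵇ t ≢ true) →
                  2 ≤ sum (λ i → 1 * maybe′ (entering C) 0 (link-arc i))
  two-link-arcs {C} C∈𝓛 all-matched
    with t₁ , t₁∈T   ← terminal-exists feasible leaf-to-leaf (proj₁ (in-𝒞ᴹ C∈𝓛))
    with i₁ , i₁∈M , end₁ ← matched-terminal t₁∈T (all-matched t₁ t₁∈T)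
    with any? (λ t → InTC? C t ×-dec ¬? (endpoint? t (L i₁)))
  ... | no only-ends-of-i₁ = ⊥-elim (no-bad i₁ i₁∈M (C , proj₁ (in-𝒞ᴹ C∈𝓛) , T⊆ends , ends-in))
    where
    ends-in = uncovered-end-in⇒ends-in (proj₂ (in-𝒞ᴹ C∈𝓛) i₁ i₁∈M) end₁ (proj₁ t₁∈T)
    T⊆ends : ∀ t → InTC E L C t → t ≡ proj₁ (L i₁) ⊎ t ≡ proj₂ (L i₁)
    T⊆ends t t∈T with endpoint? t (L i₁)
    ... | yes (inj₁ p₁≡t) = inj₁ (sym p₁≡t)
    ... | yes (inj₂ p₂≡t) = inj₂ (sym p₂≡t)
    ... | no ¬end = ⊥-elim (only-ends-of-i₁ (t , t∈T , ¬end))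
  ... | yes (t₂ , t₂∈T , ¬end₂) with i₂ , i₂∈M , end₂ ← matched-terminal t₂∈T (all-matched t₂ t₂∈T) =
    subst (_≤ sum arc-at) (cong₂ _+_ (cong (1 *_) (link-arc-enters C∈𝓛 i₁∈M t₁∈T end₁))
                                     (cong (1 *_) (link-arc-enters C∈𝓛 i₂∈M t₂∈T end₂)))
          (two-terms≤sum arc-at i₁≢i₂)
    where
    arc-at = λ i → 1 * maybe′ (entering C) 0 (link-arc i)
    i₁≢i₂ : i₁ ≢ i₂
    i₁≢i₂ refl = ¬end₂ end₂

  two≤inflow : ∀ {C} → C ∈ˡ 𝓛 → 2 ≤ ⟪ entering C , twice-x ⟫
  two≤inflow {C} C∈𝓛 rewrite ⟪⟫-twice-x (entering C) with any? (λ t → InTC? C t ×-dec (unmatchedᵇ t Bool.≟ true))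
  ... | yes (t , t∈T , unmatched) =
    ℕ.≤-trans (subst (_≤ sum leaf-term) (cong (2 *_) (leaf-arc-enters C∈𝓛 t∈T unmatched)) (term≤sum leaf-term t))
              (ℕ.m≤m+n _ _)
    where leaf-term = λ t → 2 * maybe′ (entering C) 0 (leaf-arc t)
  ... | no none-unmatched =
    ℕ.≤-trans (two-link-arcs C∈𝓛 (λ t t∈T unmatched → none-unmatched (t , t∈T , unmatched))) (ℕ.m≤n+m _ _)

  value≤ : ⟪ (λ _ → 1) , twice-x ⟫ ≤ ∣ Min ∣ + 2 * (numLeaves E ∸ 2 * ∣ M ∣)
  value≤ = ℕ.≤-trans value-bound
    (ℕ.+-monoʳ-≤ ∣ Min ∣ (ℕ.*-monoʳ-≤ 2 (ℕ.m+n≤o⇒m≤o∸n (count unmatchedᵇ) unmatched-bound)))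

  matched≤leaves : 2 * ∣ M ∣ ≤ numLeaves E
  matched≤leaves = ℕ.m+n≤o⇒n≤o (count unmatchedᵇ) unmatched-bound

open import Data.Nat using (ℕ; _*_)
open import Data.Fin using (Fin)
open import Data.Fin.Subset using (Subset; _∈_; ∣_∣)
open import Data.List using (List)
open import Data.List.Relation.Unary.All using (All)
open import Data.Product using (_×_; ∃-syntax)
open import Relation.Nullary using (¬_)
open import Data.Integer using (+_; _-_)
open import Data.Rational using (ℚ; _/_; _+_; _≤_)

lemma13 : ∀ {n m k} (E : Edges n m) (L : Links n k) (r : Fin n)
    → IsCactus E → IsLinkSet L → Feasible E L → LeafToLeafPlus E L r
    → (M : Subset k) → IsLeafMatching E L M → (∀ i → i ∈ M → ¬ Bad E L r (L i))
    → (Min : Subset k) → (∀ i → (i ∈ Min → i ∈ M × InLink E r (L i)) × (i ∈ M × InLink E r (L i) → i ∈ Min))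
    → (𝓛 : List (Subset n)) → All (InFamCM E L r M) 𝓛 → Laminar 𝓛
    → ∃[ xf ] ∃[ xb ] (LPFeasible L 𝓛 xf xb ×
        total xf xb ≤ ((+ ∣ Min ∣) / 2 + ((+ numLeaves E) - (+ (2 * ∣ M ∣))) / 1))
lemma13 E L r cactus link-set feasible leaf-to-leaf M matching no-bad Min Min-spec 𝓛 𝓛⊆𝒞ᴹ laminar =
  xᶠ twice-x , xᵇ twice-x , halved-feasible twice-x 𝓛 two≤inflow , total≤
  where
  open FractionalPoint E L r cactus link-set feasible leaf-to-leaf M matching no-bad Min Min-spec 𝓛 𝓛⊆𝒞ᴹ laminar
  open Instance E L r using (xᶠ; xᵇ; halved-feasible; total-half)
  open import Data.Product using (_,_)
  open import Relation.Binary.PropositionalEquality using (subst; sym)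

  total≤ : total (xᶠ twice-x) (xᵇ twice-x) ≤ (+ ∣ Min ∣) / 2 + ((+ numLeaves E) - (+ (2 * ∣ M ∣))) / 1
  total≤ = subst (_≤ _) (sym (total-half twice-x)) (Half.half-≤-split {b = ∣ Min ∣} value≤ matched≤leaves)
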